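{- Let $P$ be a $2\times k$ zero-one matrix that does not contain a $2\times 2$ homogeneous submatrix. Then there is a constant $c>0$ such that every unordered $P$-free $n\times n$ zero-one matrix $A$ contains a homogeneous $cn\times cn$ submatrix.
   Context: A matrix is homogeneous if all its entries are equal. A submatrix of $A$ is the restriction of $A$ to a set of rows and a set of columns (in original order); an $s\times t$ submatrix has $s$ rows and $t$ columns. A zero-one matrix $A$ is unordered $P$-free if $A$ contains no submatrix whose rows and columns can be permuted to obtain $P$. Floors and ceilings are omitted. -}

module Defs where

open import Data.Nat using (ℕ; _*_; _≤_; _<_; suc)
open import Data.Fin using (Fin; toℕ) renaming (_<_ to _<ᶠ_)
open import Data.Bool using (Bool)
open import Data.Product using (Σ; ∃; _×_; _,_)
open import Relation.Binary.PropositionalEquality using (_≡_)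
open import Relation.Nullary using (¬_)
open import Function.Definitions using (Injective)

Matrix : ℕ → ℕ → Set
Matrix m n = Fin m → Fin n → Bool

StrictMono : ∀ {s n} → (Fin s → Fin n) → Set
StrictMono {s} f = ∀ (i j : Fin s) → i <ᶠ j → f i <ᶠ f j

sub : ∀ {m n s t} → Matrix m n → (Fin s → Fin m) → (Fin t → Fin n) → Matrix s t
sub A r c i j = A (r i) (c j)

Homogeneous : ∀ {s t} → Matrix s t → Set
Homogeneous {s} {t} B = ∀ (i i′ : Fin s) (j j′ : Fin t) → B i j ≡ B i′ j′

HasHomogeneousSub : ∀ {m n} → Matrix m n → ℕ → ℕ → Set
HasHomogeneousSub {m} {n} A s t =
  Σ (Fin s → Fin m) λ r → Σ (Fin t → Fin n) λ c →
    StrictMono r × StrictMono c × Homogeneous (sub A r c)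

-- A contains a submatrix whose rows and columns can be permuted to obtain P:
-- equivalently, injective (not necessarily increasing) row and column maps
-- along which A agrees with P.
ContainsUnordered : ∀ {m n p q} → Matrix m n → Matrix p q → Set
ContainsUnordered {m} {n} {p} {q} A P =
  Σ (Fin p → Fin m) λ r → Σ (Fin q → Fin n) λ c →
    Injective _≡_ _≡_ r × Injective _≡_ _≡_ c ×
    (∀ i j → A (r i) (c j) ≡ P i j)

UnorderedFree : ∀ {m n p q} → Matrix m n → Matrix p q → Set
UnorderedFree A P = ¬ ContainsUnordered A P

NoHomogeneous2x2 : ∀ {m n} → Matrix m n → Set
NoHomogeneous2x2 A = ¬ HasHomogeneousSub A 2 2

-- Since P has no homogeneous 2 × 2 submatrix, it has at most one column (0,0)ᵀ and at most one
-- column (1,1)ᵀ, so up to a column permutation it is a submatrix of Q_k, the 2 × (2k+2) matrix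
-- with k columns (1,0)ᵀ, k columns (0,1)ᵀ, one (0,0)ᵀ and one (1,1)ᵀ; hence A is unordered
-- Q_k-free.  Complementing A if necessary, at least half of its rows are sparse (at most n/2
-- ones).  Repeatedly take a waiting sparse row x with the most ones.  A waiting row meeting x in a
-- one also meets it in a zero, so by Q_k-freeness it has at most k ones outside those of x and is
-- absorbed; every other waiting row avoids the ones of x, which join the collected columns.
-- Either the collected columns reach n/4 and span a zero block with the (more than n/4) waiting
-- rows, or half of the sparse rows get absorbed; these have at most k ones outside the (at most
-- 3n/4) collected columns, and n/4 rows and columns with at most k ones per row contain a zero
-- block of size n/(4(k+1)).

module Submission where

open import Defs
open import Algebra.Properties.CommutativeSemigroup using (interchange)
open import Data.Bool using (Bool; true; false; not; _∧_; _∨_)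
import Data.Bool.Properties as Bool
open import Data.Empty using (⊥; ⊥-elim)
open import Data.Fin using (Fin; zero; suc) renaming (_<_ to _<ᶠ_)
import Data.Fin.Properties as Fin
open import Data.List using (List; allFin; filter)
open import Data.List.Extrema.Nat using (argmax; argmax-all; f[xs]≤f[argmax])
open import Data.List.Membership.Propositional.Properties using (∈-allFin; ∈-filter⁺)
open import Data.List.Relation.Unary.All using (lookup)
open import Data.List.Relation.Unary.All.Properties using (all-filter)
open import Data.Nat
open import Data.Nat.DivMod using (_/_; _%_; m≡m%n+[m/n]*n; m%n<n; m/n*n≤m; m≥n⇒m/n>0)
open import Data.Nat.Induction using (<-wellFounded)
open import Data.Nat.Properties
open import Data.Nat.Tactic.RingSolver using (solve-∀)
open import Data.Product using (Σ; ∃; _×_; _,_; proj₁; proj₂; swap)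
open import Data.Sum using (_⊎_; inj₁; inj₂)
import Data.Sum as Sum
open import Data.Vec.Functional using (_∷_; []; tail)
open import Function using (case_of_)
open import Function.Definitions using (Injective)
open import Induction.WellFounded using (Acc; acc)
open import Relation.Binary using (tri<; tri≈; tri>)
open import Relation.Binary.PropositionalEquality
open import Relation.Nullary using (¬_; Dec; yes; no; does)
open import Relation.Unary using (Decidable)

private variable
  m n k s : ℕ

-- Finite sets as Boolean predicates

infix 4 _∈_ _⊆_
infixr 7 _∩_
infixr 6 _∪_ _─_

_∈_ : Fin n → (Fin n → Bool) → Set
j ∈ p = p j ≡ true

_⊆_ : (Fin n → Bool) → (Fin n → Bool) → Set
p ⊆ q = ∀ {j} → j ∈ p → j ∈ q

∅ : Fin n → Bool
∅ _ = false

∁ : (Fin n → Bool) → Fin n → Bool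
∁ p j = not (p j)

_∩_ _∪_ _─_ : (Fin n → Bool) → (Fin n → Bool) → Fin n → Bool
(p ∩ q) j = p j ∧ q j
(p ∪ q) j = p j ∨ q j
p ─ q = p ∩ ∁ q

setOf : {P : Fin n → Set} → Decidable P → Fin n → Bool
setOf P? j = does (P? j)

indicator : Bool → ℕ
indicator true  = 1
indicator false = 0

∣_∣ : (Fin n → Bool) → ℕ
∣_∣ {zero}  p = 0
∣_∣ {suc n} p = indicator (p zero) + ∣ tail p ∣

private variable
  p q : Fin n → Bool

∈setOf⁻ : {P : Fin n → Set} (P? : Decidable P) {j : Fin n} → j ∈ setOf P? → P j
∈setOf⁻ P? {j} j∈ with P? j
... | yes Pj = Pj

∈setOf⁺ : {P : Fin n → Set} (P? : Decidable P) {j : Fin n} → P j → j ∈ setOf P?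
∈setOf⁺ P? {j} Pj with P? j
... | yes _ = refl
... | no ¬Pj = ⊥-elim (¬Pj Pj)

∉setOf⁻ : {P : Fin n → Set} (P? : Decidable P) {j : Fin n} → setOf P? j ≡ false → ¬ P j
∉setOf⁻ P? {j} j∉ Pj with P? j
... | no ¬Pj = ¬Pj Pj

∈∩⁻ : (p q : Fin n → Bool) → ∀ {j} → j ∈ p ∩ q → j ∈ p × j ∈ q
∈∩⁻ p q {j} j∈ with p j | q j
... | true | true = refl , refl

∈∩⁺ : (p q : Fin n → Bool) → ∀ {j} → j ∈ p → j ∈ q → j ∈ p ∩ q
∈∩⁺ p q j∈p j∈q rewrite j∈p | j∈q = refl

∈─⁻ : (p q : Fin n → Bool) → ∀ {j} → j ∈ p ─ q → j ∈ p × q j ≡ false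
∈─⁻ p q {j} j∈ with p j | q j
... | true | false = refl , refl

∈─⁺ : (p q : Fin n → Bool) → ∀ {j} → j ∈ p → q j ≡ false → j ∈ p ─ q
∈─⁺ p q j∈p j∉q rewrite j∈p | j∉q = refl

∈∁∪⁻ : (p q : Fin n → Bool) → ∀ {j} → j ∈ ∁ (p ∪ q) → p j ≡ false × q j ≡ false
∈∁∪⁻ p q {j} j∈ with p j | q j
... | false | false = refl , refl

∈∪⁻ : (p q : Fin n → Bool) → ∀ {j} → j ∈ p ∪ q → j ∈ p ⊎ j ∈ q
∈∪⁻ p q {j} j∈ with p j
... | true  = inj₁ refl
... | false = inj₂ j∈

∈∪⁺ : (p q : Fin n → Bool) → ∀ {j} → j ∈ p ⊎ j ∈ q → j ∈ p ∪ q
∈∪⁺ p q (inj₁ j∈p) rewrite j∈p = refl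
∈∪⁺ p q {j} (inj₂ j∈q) rewrite j∈q = Bool.∨-zeroʳ (p j)

p⊆p∪q : (p q : Fin n → Bool) → p ⊆ p ∪ q
p⊆p∪q p q j∈p = ∈∪⁺ p q (inj₁ j∈p)

q⊆p∪q : (p q : Fin n → Bool) → q ⊆ p ∪ q
q⊆p∪q p q j∈q = ∈∪⁺ p q (inj₂ j∈q)

⊆⇒∉ : (q r : Fin n → Bool) → q ⊆ r → ∀ {j} → r j ≡ false → q j ≡ false
⊆⇒∉ q r q⊆r {j} j∉r with q j in qj
... | false = refl
... | true  = trans (sym (q⊆r qj)) j∉r

─-antitoneʳ : (p q r : Fin n → Bool) → q ⊆ r → p ─ r ⊆ p ─ q
─-antitoneʳ p q r q⊆r j∈p─r =
  let j∈p , j∉r = ∈─⁻ p r j∈p─r in ∈─⁺ p q j∈p (⊆⇒∉ q r q⊆r j∉r)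

∣∣-cong : (∀ j → p j ≡ q j) → ∣ p ∣ ≡ ∣ q ∣
∣∣-cong {zero}  p≗q = refl
∣∣-cong {suc n} p≗q = cong₂ _+_ (cong indicator (p≗q zero)) (∣∣-cong (λ j → p≗q (suc j)))

∣∣-additive : {p q p′ q′ : Fin n → Bool} →
  (∀ j → indicator (p j) + indicator (q j) ≡ indicator (p′ j) + indicator (q′ j)) →
  ∣ p ∣ + ∣ q ∣ ≡ ∣ p′ ∣ + ∣ q′ ∣
∣∣-additive {zero}  eq = refl
∣∣-additive {suc n} {p} {q} {p′} {q′} eq = begin
  (indicator (p zero) + ∣ tail p ∣) + (indicator (q zero) + ∣ tail q ∣)
    ≡⟨ interchange +-commutativeSemigroup (indicator (p zero)) _ _ _ ⟩
  (indicator (p zero) + indicator (q zero)) + (∣ tail p ∣ + ∣ tail q ∣)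
    ≡⟨ cong₂ _+_ (eq zero) (∣∣-additive (λ j → eq (suc j))) ⟩
  (indicator (p′ zero) + indicator (q′ zero)) + (∣ tail p′ ∣ + ∣ tail q′ ∣)
    ≡⟨ interchange +-commutativeSemigroup (indicator (p′ zero)) _ _ _ ⟩
  (indicator (p′ zero) + ∣ tail p′ ∣) + (indicator (q′ zero) + ∣ tail q′ ∣) ∎
  where open ≡-Reasoning

∣∅∣≡0 : ∀ n → ∣ ∅ {n} ∣ ≡ 0
∣∅∣≡0 zero    = refl
∣∅∣≡0 (suc n) = ∣∅∣≡0 n

∣p∣≡n : {p : Fin n → Bool} → (∀ j → j ∈ p) → ∣ p ∣ ≡ n
∣p∣≡n {zero}  all∈ = refl
∣p∣≡n {suc n} {p} all∈ rewrite all∈ zero = cong suc (∣p∣≡n (λ j → all∈ (suc j)))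

∈⇒0<∣p∣ : (p : Fin n → Bool) → ∀ {j} → j ∈ p → 0 < ∣ p ∣
∈⇒0<∣p∣ p {zero}  j∈p rewrite j∈p = s≤s z≤n
∈⇒0<∣p∣ p {suc j} j∈p = ≤-trans (∈⇒0<∣p∣ (tail p) j∈p) (m≤n+m _ _)

∣p∩q∣≡0⇒∉ : (p : Fin n → Bool) → ∀ {q j} → ∣ p ∩ q ∣ ≡ 0 → j ∈ q → p j ≡ false
∣p∩q∣≡0⇒∉ p {q} {j} ∣p∩q∣≡0 j∈q with p j in pj
... | false = refl
... | true  = ⊥-elim (<-irrefl (sym ∣p∩q∣≡0) (∈⇒0<∣p∣ (p ∩ q) (∈∩⁺ p q pj j∈q)))

0<∣p∣⇒∃∈ : (p : Fin n → Bool) → 0 < ∣ p ∣ → ∃ λ j → j ∈ p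
0<∣p∣⇒∃∈ {suc n} p 0<∣p∣ with p zero in p₀
... | true  = zero , p₀
... | false = let j , j∈p = 0<∣p∣⇒∃∈ (tail p) 0<∣p∣ in suc j , j∈p

∣p∣≡∣p∩q∣+∣p─q∣ : (p q : Fin n → Bool) → ∣ p ∣ ≡ ∣ p ∩ q ∣ + ∣ p ─ q ∣
∣p∣≡∣p∩q∣+∣p─q∣ {n} p q = begin
  ∣ p ∣                     ≡⟨ sym (+-identityʳ _) ⟩
  ∣ p ∣ + 0                 ≡⟨ cong (∣ p ∣ +_) (sym (∣∅∣≡0 n)) ⟩
  ∣ p ∣ + ∣ ∅ {n} ∣         ≡⟨ ∣∣-additive {q = ∅} {p ∩ q} {p ─ q} (λ j → split (p j) (q j)) ⟩
  ∣ p ∩ q ∣ + ∣ p ─ q ∣     ∎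
  where
  open ≡-Reasoning
  split : ∀ a b → indicator a + 0 ≡ indicator (a ∧ b) + indicator (a ∧ not b)
  split true  true  = refl
  split true  false = refl
  split false _     = refl

∣p∣+∣q∣≡∣p∪q∣+∣p∩q∣ : (p q : Fin n → Bool) → ∣ p ∣ + ∣ q ∣ ≡ ∣ p ∪ q ∣ + ∣ p ∩ q ∣
∣p∣+∣q∣≡∣p∪q∣+∣p∩q∣ p q = ∣∣-additive {p′ = p ∪ q} {p ∩ q} (λ j → inclusion–exclusion (p j) (q j))
  where
  inclusion–exclusion : ∀ a b → indicator a + indicator b ≡ indicator (a ∨ b) + indicator (a ∧ b)
  inclusion–exclusion true  true  = refl
  inclusion–exclusion true  false = refl
  inclusion–exclusion false true  = refl
  inclusion–exclusion false false = refl

∣p∣+∣∁p∣≡n : (p : Fin n → Bool) → ∣ p ∣ + ∣ ∁ p ∣ ≡ n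
∣p∣+∣∁p∣≡n {n} p = begin
  ∣ p ∣ + ∣ ∁ p ∣                        ≡⟨ ∣∣-additive {p′ = λ _ → true} {∅} (λ j → excluded-middle (p j)) ⟩
  ∣ (λ (_ : Fin n) → true) ∣ + ∣ ∅ {n} ∣ ≡⟨ cong₂ _+_ (∣p∣≡n (λ _ → refl)) (∣∅∣≡0 n) ⟩
  n + 0                                  ≡⟨ +-identityʳ n ⟩
  n                                      ∎
  where
  open ≡-Reasoning
  excluded-middle : ∀ a → indicator a + indicator (not a) ≡ 1 + 0
  excluded-middle true  = refl
  excluded-middle false = refl

∣p∪q∣≤∣p∣+∣q∣ : (p q : Fin n → Bool) → ∣ p ∪ q ∣ ≤ ∣ p ∣ + ∣ q ∣
∣p∪q∣≤∣p∣+∣q∣ p q = subst (∣ p ∪ q ∣ ≤_) (sym (∣p∣+∣q∣≡∣p∪q∣+∣p∩q∣ p q)) (m≤m+n _ _)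

p⊆q⇒∣q∣≡∣p∣+∣q─p∣ : (p q : Fin n → Bool) → p ⊆ q → ∣ q ∣ ≡ ∣ p ∣ + ∣ q ─ p ∣
p⊆q⇒∣q∣≡∣p∣+∣q─p∣ p q p⊆q =
  trans (∣p∣≡∣p∩q∣+∣p─q∣ q p) (cong (_+ ∣ q ─ p ∣) (∣∣-cong q∩p≗p))
  where
  q∩p≗p : ∀ j → q j ∧ p j ≡ p j
  q∩p≗p j with p j in pj
  ... | true  = cong (_∧ true) (p⊆q pj)
  ... | false = Bool.∧-zeroʳ (q j)

p⊆q⇒∣p∣≤∣q∣ : (p q : Fin n → Bool) → p ⊆ q → ∣ p ∣ ≤ ∣ q ∣
p⊆q⇒∣p∣≤∣q∣ p q p⊆q = subst (∣ p ∣ ≤_) (sym (p⊆q⇒∣q∣≡∣p∣+∣q─p∣ p q p⊆q)) (m≤m+n _ _)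

p⊆q⇒∣p∣<∣q∣ : (p q : Fin n → Bool) → p ⊆ q → ∀ {j} → j ∈ q → p j ≡ false → ∣ p ∣ < ∣ q ∣
p⊆q⇒∣p∣<∣q∣ p q p⊆q j∈q j∉p = subst (∣ p ∣ <_) (sym (p⊆q⇒∣q∣≡∣p∣+∣q─p∣ p q p⊆q))
  (m<m+n ∣ p ∣ (∈⇒0<∣p∣ (q ─ p) (∈─⁺ q p j∈q j∉p)))

∣p─p∣≡0 : (p : Fin n → Bool) → ∣ p ─ p ∣ ≡ 0
∣p─p∣≡0 {n} p = trans (∣∣-cong (λ j → Bool.∧-inverseʳ (p j))) (∣∅∣≡0 n)

r⊆q⇒∣p∩q∣≡∣p∩r∣+∣p∩[q─r]∣ : (p q r : Fin n → Bool) → r ⊆ q → ∣ p ∩ q ∣ ≡ ∣ p ∩ r ∣ + ∣ p ∩ (q ─ r) ∣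
r⊆q⇒∣p∩q∣≡∣p∩r∣+∣p∩[q─r]∣ p q r r⊆q = begin
  ∣ p ∩ q ∣                          ≡⟨ p⊆q⇒∣q∣≡∣p∣+∣q─p∣ (p ∩ r) (p ∩ q) p∩r⊆p∩q ⟩
  ∣ p ∩ r ∣ + ∣ (p ∩ q) ─ (p ∩ r) ∣  ≡⟨ cong (∣ p ∩ r ∣ +_) (∣∣-cong (λ j → distrib (p j) (q j) (r j))) ⟩
  ∣ p ∩ r ∣ + ∣ p ∩ (q ─ r) ∣        ∎
  where
  open ≡-Reasoning
  p∩r⊆p∩q : p ∩ r ⊆ p ∩ q
  p∩r⊆p∩q j∈ = let j∈p , j∈r = ∈∩⁻ p r j∈ in ∈∩⁺ p q j∈p (r⊆q j∈r)
  distrib : ∀ a b c → (a ∧ b) ∧ not (a ∧ c) ≡ a ∧ (b ∧ not c)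
  distrib true  b c = refl
  distrib false b c = refl

subset-of-size : ∀ s (p : Fin n → Bool) → s ≤ ∣ p ∣ → ∃ λ q → q ⊆ p × ∣ q ∣ ≡ s
subset-of-size {n}     zero    p _ = ∅ , (λ ()) , ∣∅∣≡0 n
subset-of-size {zero}  (suc s) p ()
subset-of-size {suc n} (suc s) p s<∣p∣ with p zero in p₀
... | true = let q , q⊆p , ∣q∣≡s = subset-of-size s (tail p) (s≤s⁻¹ s<∣p∣) in
  (true ∷ q) , (λ { {zero} _ → p₀ ; {suc j} j∈q → q⊆p j∈q }) , cong suc ∣q∣≡s
... | false = let q , q⊆p , ∣q∣≡s = subset-of-size (suc s) (tail p) s<∣p∣ in
  (false ∷ q) , (λ { {suc j} j∈q → q⊆p j∈q }) , ∣q∣≡s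

choose-increasing : ∀ s (p : Fin n → Bool) → s ≤ ∣ p ∣ →
  Σ (Fin s → Fin n) λ f → StrictMono f × (∀ i → f i ∈ p)
choose-increasing         zero    p _ = (λ ()) , (λ ()) , (λ ())
choose-increasing {zero}  (suc s) p ()
choose-increasing {suc n} (suc s) p s<∣p∣ with p zero in p₀
... | true = let f , f↑ , f∈p = choose-increasing s (tail p) (s≤s⁻¹ s<∣p∣) in
  (zero ∷ λ i → suc (f i)) , increasing f↑ , (λ { zero → p₀ ; (suc i) → f∈p i })
  where
  increasing : ∀ {f : Fin s → Fin n} → StrictMono f → StrictMono (zero ∷ λ i → suc (f i))
  increasing f↑ zero    (suc j) _         = s≤s z≤n
  increasing f↑ (suc i) (suc j) (s≤s i<j) = s≤s (f↑ i j i<j)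
... | false = let f , f↑ , f∈p = choose-increasing (suc s) (tail p) s<∣p∣ in
  (λ i → suc (f i)) , (λ i j i<j → s≤s (f↑ i j i<j)) , f∈p

strictMono⇒injective : {f : Fin s → Fin n} → StrictMono f → Injective _≡_ _≡_ f
strictMono⇒injective {f = f} f↑ {i} {j} fi≡fj with Fin.<-cmp i j
... | tri< i<j _ _ = ⊥-elim (Fin.<-irrefl fi≡fj (f↑ i j i<j))
... | tri≈ _ i≡j _ = i≡j
... | tri> _ _ j<i = ⊥-elim (Fin.<-irrefl (sym fi≡fj) (f↑ j i j<i))

argmax-on : (f : Fin n → ℕ) → ∀ {j} → j ∈ p → ∃ λ x → x ∈ p × (∀ {y} → y ∈ p → f y ≤ f x)
argmax-on {n} {p} f {j} j∈p = x , argmax-all f j∈p (all-filter p? (allFin n)) , maximal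
  where
  p? : Decidable (_∈ p)
  p? y = p y Bool.≟ true
  candidates : List (Fin n)
  candidates = filter p? (allFin n)
  x : Fin n
  x = argmax f j candidates
  maximal : ∀ {y} → y ∈ p → f y ≤ f x
  maximal y∈p = lookup (f[xs]≤f[argmax] j candidates) (∈-filter⁺ p? (∈-allFin _) y∈p)

2m≤o⇒2n≤o⇒m+n≤o : ∀ a b {c} → 2 * a ≤ c → 2 * b ≤ c → a + b ≤ c
2m≤o⇒2n≤o⇒m+n≤o a b {c} 2a≤c 2b≤c = *-cancelˡ-≤ 2 (begin
  2 * (a + b)    ≡⟨ *-distribˡ-+ 2 a b ⟩
  2 * a + 2 * b  ≤⟨ +-mono-≤ 2a≤c 2b≤c ⟩
  c + c          ≡⟨ double c ⟩
  2 * c          ∎)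
  where
  open ≤-Reasoning
  double : ∀ c → c + c ≡ 2 * c
  double = solve-∀

m+n≡o⇒2m≤o⊎2n≤o : ∀ a b {c} → a + b ≡ c → 2 * a ≤ c ⊎ 2 * b ≤ c
m+n≡o⇒2m≤o⊎2n≤o a b {c} a+b≡c with 2 * a ≤? c | 2 * b ≤? c
... | yes 2a≤c | _        = inj₁ 2a≤c
... | no _     | yes 2b≤c = inj₂ 2b≤c
... | no 2a≰c  | no 2b≰c  = ⊥-elim (<-irrefl (cong (2 *_) (sym a+b≡c)) (begin-strict
  2 * c          ≡⟨ double c ⟨
  c + c          <⟨ +-mono-< (≰⇒> 2a≰c) (≰⇒> 2b≰c) ⟩
  2 * a + 2 * b  ≡⟨ *-distribˡ-+ 2 a b ⟨
  2 * (a + b)    ∎))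
  where
  open ≤-Reasoning
  double : ∀ c → c + c ≡ 2 * c
  double = solve-∀

m≤n+o⇒m≤2n⊎m≤2o : ∀ a b {c} → c ≤ a + b → c ≤ 2 * a ⊎ c ≤ 2 * b
m≤n+o⇒m≤2n⊎m≤2o a b {c} c≤a+b with c ≤? 2 * a | c ≤? 2 * b
... | yes c≤2a | _        = inj₁ c≤2a
... | no _     | yes c≤2b = inj₂ c≤2b
... | no c≰2a  | no c≰2b  = ⊥-elim (<⇒≱ (+-mono-< (≰⇒> c≰2a) (≰⇒> c≰2b)) (begin
  c + c          ≤⟨ +-mono-≤ c≤a+b c≤a+b ⟩
  (a + b) + (a + b)  ≡⟨ rearrange a b ⟩
  2 * a + 2 * b  ∎))
  where
  open ≤-Reasoning
  rearrange : ∀ a b → (a + b) + (a + b) ≡ 2 * a + 2 * b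
  rearrange = solve-∀

m≡n+o⇒2n≤m⇒m≤2o : ∀ a b {c} → a ≡ b + c → 2 * b ≤ a → a ≤ 2 * c
m≡n+o⇒2n≤m⇒m≤2o a b {c} a≡b+c 2b≤a = +-cancelˡ-≤ a a (2 * c) (begin
  a + a          ≡⟨ double a ⟩
  2 * a          ≡⟨ cong (2 *_) a≡b+c ⟩
  2 * (b + c)    ≡⟨ *-distribˡ-+ 2 b c ⟩
  2 * b + 2 * c  ≤⟨ +-monoˡ-≤ (2 * c) 2b≤a ⟩
  a + 2 * c      ∎)
  where
  open ≤-Reasoning
  double : ∀ a → a + a ≡ 2 * a
  double = solve-∀

m+n≡o⇒4m≤3o⇒o≤4n : ∀ a b {c} → a + b ≡ c → 4 * a ≤ 3 * c → c ≤ 4 * b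
m+n≡o⇒4m≤3o⇒o≤4n a b {c} a+b≡c 4a≤3c = +-cancelˡ-≤ (3 * c) c (4 * b) (begin
  3 * c + c      ≡⟨ split c ⟩
  4 * c          ≡⟨ cong (4 *_) a+b≡c ⟨
  4 * (a + b)    ≡⟨ *-distribˡ-+ 4 a b ⟩
  4 * a + 4 * b  ≤⟨ +-monoˡ-≤ (4 * b) 4a≤3c ⟩
  3 * c + 4 * b  ∎)
  where
  open ≤-Reasoning
  split : ∀ c → 3 * c + c ≡ 4 * c
  split = solve-∀

4m≤o⇒2n≤o⇒4[m+n]≤3o : ∀ a b {c} → 4 * a ≤ c → 2 * b ≤ c → 4 * (a + b) ≤ 3 * c
4m≤o⇒2n≤o⇒4[m+n]≤3o a b {c} 4a≤c 2b≤c = begin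
  4 * (a + b)          ≡⟨ split a b ⟩
  4 * a + 2 * (2 * b)  ≤⟨ +-mono-≤ 4a≤c (*-monoʳ-≤ 2 2b≤c) ⟩
  c + 2 * c            ≡⟨ join c ⟩
  3 * c                ∎
  where
  open ≤-Reasoning
  split : ∀ a b → 4 * (a + b) ≡ 4 * a + 2 * (2 * b)
  split = solve-∀
  join : ∀ c → c + 2 * c ≡ 3 * c
  join = solve-∀

record HomogeneousBlock (A : Matrix m n) (s : ℕ) : Set where
  field
    rows        : Fin m → Bool
    columns     : Fin n → Bool
    value       : Bool
    s≤∣rows∣    : s ≤ ∣ rows ∣
    s≤∣columns∣ : s ≤ ∣ columns ∣
    constant    : ∀ {i j} → i ∈ rows → j ∈ columns → A i j ≡ value

block⇒homogeneousSub : {A : Matrix m n} → HomogeneousBlock A s → HasHomogeneousSub A s s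
block⇒homogeneousSub {s = s} block =
  let r , r↑ , r∈rows    = choose-increasing s rows s≤∣rows∣
      c , c↑ , c∈columns = choose-increasing s columns s≤∣columns∣
  in r , c , r↑ , c↑ , λ i i′ j j′ →
     trans (constant (r∈rows i) (c∈columns j)) (sym (constant (r∈rows i′) (c∈columns j′)))
  where open HomogeneousBlock block

complement : Matrix m n → Matrix m n
complement A i = ∁ (A i)

block-complement : {A : Matrix m n} → HomogeneousBlock (complement A) s → HomogeneousBlock A s
block-complement block = record
  { rows = rows ; columns = columns ; value = not value
  ; s≤∣rows∣ = s≤∣rows∣ ; s≤∣columns∣ = s≤∣columns∣
  ; constant = λ i∈ j∈ → trans (sym (Bool.not-involutive _)) (cong not (constant i∈ j∈))
  }
  where open HomogeneousBlock block

zero-block : {A : Matrix m n} (S : Fin m → Bool) (C : Fin n → Bool) →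
  s ≤ ∣ S ∣ → s ≤ ∣ C ∣ → (∀ {i j} → i ∈ S → j ∈ C → A i j ≡ false) → HomogeneousBlock A s
zero-block S C s≤∣S∣ s≤∣C∣ zero-entries = record
  { rows = S ; columns = C ; value = false
  ; s≤∣rows∣ = s≤∣S∣ ; s≤∣columns∣ = s≤∣C∣ ; constant = zero-entries }

-- Fix s columns C₁ ⊆ C.  Either s rows of S vanish on C₁, or the other rows of S (all but fewer
-- than s) have a one in C₁, hence at most k − 1 ones in C ─ C₁, and induction on k applies.
sparse⇒block : (A : Matrix m n) (S : Fin m → Bool) (C : Fin n → Bool) →
  suc k * s ≤ ∣ S ∣ → suc k * s ≤ ∣ C ∣ → (∀ {i} → i ∈ S → ∣ A i ∩ C ∣ ≤ k) →
  HomogeneousBlock A s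
sparse⇒block {k = zero} {s} A S C ∣S∣≥ ∣C∣≥ sparse =
  zero-block S C (≤-trans (m≤m+n s 0) ∣S∣≥) (≤-trans (m≤m+n s 0) ∣C∣≥)
    (λ {i} i∈S j∈C → ∣p∩q∣≡0⇒∉ (A i) (n≤0⇒n≡0 (sparse i∈S)) j∈C)
sparse⇒block {m} {n} {suc k} {s} A S C ∣S∣≥ ∣C∣≥ sparse =
  let C₁ , C₁⊆C , ∣C₁∣≡s = subset-of-size s C (≤-trans (m≤m+n s _) ∣C∣≥) in
  split C₁ C₁⊆C ∣C₁∣≡s (s ≤? ∣ S ∩ avoiding C₁ ∣)
  where
  avoiding : (Fin n → Bool) → Fin m → Bool
  avoiding C₁ = setOf (λ i → ∣ A i ∩ C₁ ∣ ≟ 0)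

  split : ∀ C₁ → C₁ ⊆ C → ∣ C₁ ∣ ≡ s → Dec (s ≤ ∣ S ∩ avoiding C₁ ∣) → HomogeneousBlock A s
  split C₁ C₁⊆C ∣C₁∣≡s (yes s≤) =
    zero-block (S ∩ avoiding C₁) C₁ s≤ (≤-reflexive (sym ∣C₁∣≡s))
      λ {i} i∈ j∈C₁ →
        ∣p∩q∣≡0⇒∉ (A i) (∈setOf⁻ (λ i → ∣ A i ∩ C₁ ∣ ≟ 0) (proj₂ (∈∩⁻ S (avoiding C₁) i∈))) j∈C₁
  split C₁ C₁⊆C ∣C₁∣≡s (no s≰) = sparse⇒block A (S ─ avoiding C₁) (C ─ C₁)
    (remaining (≤-trans ∣S∣≥ (≤-reflexive (∣p∣≡∣p∩q∣+∣p─q∣ S (avoiding C₁)))) (<⇒≤ (≰⇒> s≰)))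
    (remaining (≤-trans ∣C∣≥ (≤-reflexive (p⊆q⇒∣q∣≡∣p∣+∣q─p∣ C₁ C C₁⊆C))) (≤-reflexive ∣C₁∣≡s))
    λ {i} i∈ → let i∈S , i∉ = ∈─⁻ S (avoiding C₁) i∈ in
      +-cancelˡ-≤ 1 _ _ (≤-trans (+-monoˡ-≤ _ (n≢0⇒n>0 (∉setOf⁻ (λ i → ∣ A i ∩ C₁ ∣ ≟ 0) i∉)))
        (≤-trans (≤-reflexive (sym (r⊆q⇒∣p∩q∣≡∣p∩r∣+∣p∩[q─r]∣ (A i) C C₁ C₁⊆C))) (sparse i∈S)))
    where
    remaining : ∀ {a b} → s + suc k * s ≤ a + b → a ≤ s → suc k * s ≤ b
    remaining s+t≤a+b a≤s = +-cancelˡ-≤ s _ _ (≤-trans s+t≤a+b (+-monoˡ-≤ _ a≤s))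

-- Pairs of rows and the matrix Q_k

-- Unordered Q_k-freeness, for the matrix Q_k described at the top.
QFree : ℕ → Matrix m n → Set
QFree k A = ∀ {x y} → x ≢ y →
  k ≤ ∣ A x ─ A y ∣ → k ≤ ∣ A y ─ A x ∣ → 0 < ∣ A x ∩ A y ∣ → 0 < ∣ ∁ (A x ∪ A y) ∣ → ⊥

homogeneous-2×2 : (P : Matrix 2 k) → ∀ {i j v} → i <ᶠ j →
  P zero i ≡ v → P (suc zero) i ≡ v → P zero j ≡ v → P (suc zero) j ≡ v → HasHomogeneousSub P 2 2
homogeneous-2×2 P {i} {j} {v} i<j P₀ᵢ P₁ᵢ P₀ⱼ P₁ⱼ =
  (λ a → a) , (i ∷ j ∷ []) , (λ _ _ a<b → a<b) , increasing ,
  λ a a′ b b′ → trans (entry a b) (sym (entry a′ b′))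
  where
  increasing : StrictMono (i ∷ j ∷ [])
  increasing zero (suc zero) _ = i<j
  increasing (suc zero) (suc zero) (s≤s ())
  entry : ∀ a b → P a ((i ∷ j ∷ []) b) ≡ v
  entry zero       zero       = P₀ᵢ
  entry zero       (suc zero) = P₀ⱼ
  entry (suc zero) zero       = P₁ᵢ
  entry (suc zero) (suc zero) = P₁ⱼ

constant-columns-equal : (P : Matrix 2 k) → NoHomogeneous2x2 P → ∀ {i j v} →
  P zero i ≡ v → P (suc zero) i ≡ v → P zero j ≡ v → P (suc zero) j ≡ v → i ≡ j
constant-columns-equal P noH {i} {j} P₀ᵢ P₁ᵢ P₀ⱼ P₁ⱼ with Fin.<-cmp i j
... | tri< i<j _ _ = ⊥-elim (noH (homogeneous-2×2 P i<j P₀ᵢ P₁ᵢ P₀ⱼ P₁ⱼ))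
... | tri≈ _ i≡j _ = i≡j
... | tri> _ _ j<i = ⊥-elim (noH (homogeneous-2×2 P j<i P₀ⱼ P₁ⱼ P₀ᵢ P₁ᵢ))

unorderedFree⇒QFree : (P : Matrix 2 k) → NoHomogeneous2x2 P →
  (A : Matrix m n) → UnorderedFree A P → QFree k A
unorderedFree⇒QFree {k} {m} {n} P noH A free {x} {y} x≢y k≤∣x─y∣ k≤∣y─x∣ 0<∣x∩y∣ 0<∣∁x∪y∣ =
  free (x ∷ y ∷ [] , columns , rows-injective , columns-injective , agrees)
  where
  onlyX : Σ (Fin k → Fin n) λ f → StrictMono f × (∀ i → f i ∈ A x ─ A y)
  onlyX = choose-increasing k (A x ─ A y) k≤∣x─y∣
  onlyY : Σ (Fin k → Fin n) λ f → StrictMono f × (∀ i → f i ∈ A y ─ A x)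
  onlyY = choose-increasing k (A y ─ A x) k≤∣y─x∣

  typed : Bool → Bool → Fin k → Fin n
  typed true  false   = proj₁ onlyX
  typed false true    = proj₁ onlyY
  typed true  true  _ = proj₁ (0<∣p∣⇒∃∈ (A x ∩ A y) 0<∣x∩y∣)
  typed false false _ = proj₁ (0<∣p∣⇒∃∈ (∁ (A x ∪ A y)) 0<∣∁x∪y∣)

  typed-type : ∀ a b i → A x (typed a b i) ≡ a × A y (typed a b i) ≡ b
  typed-type true  false i = ∈─⁻ (A x) (A y) (proj₂ (proj₂ onlyX) i)
  typed-type false true  i = swap (∈─⁻ (A y) (A x) (proj₂ (proj₂ onlyY) i))
  typed-type true  true  _ = ∈∩⁻ (A x) (A y) (proj₂ (0<∣p∣⇒∃∈ (A x ∩ A y) 0<∣x∩y∣))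
  typed-type false false _ = ∈∁∪⁻ (A x) (A y) (proj₂ (0<∣p∣⇒∃∈ (∁ (A x ∪ A y)) 0<∣∁x∪y∣))

  typed-injective : ∀ {a b} → a ≢ b → Injective _≡_ _≡_ (typed a b)
  typed-injective {true}  {false} _   = strictMono⇒injective (proj₁ (proj₂ onlyX))
  typed-injective {false} {true}  _   = strictMono⇒injective (proj₁ (proj₂ onlyY))
  typed-injective {true}  {true}  a≢a = ⊥-elim (a≢a refl)
  typed-injective {false} {false} a≢a = ⊥-elim (a≢a refl)

  columns : Fin k → Fin n
  columns i = typed (P zero i) (P (suc zero) i) i

  agrees : ∀ a i → A ((x ∷ y ∷ []) a) (columns i) ≡ P a i
  agrees zero       i = proj₁ (typed-type (P zero i) (P (suc zero) i) i)
  agrees (suc zero) i = proj₂ (typed-type (P zero i) (P (suc zero) i) i)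

  rows-injective : Injective _≡_ _≡_ (x ∷ y ∷ [])
  rows-injective {zero}     {zero}     _   = refl
  rows-injective {zero}     {suc zero} x≡y = ⊥-elim (x≢y x≡y)
  rows-injective {suc zero} {zero}     y≡x = ⊥-elim (x≢y (sym y≡x))
  rows-injective {suc zero} {suc zero} _   = refl

  same-type : ∀ {i j} → columns i ≡ columns j → ∀ a → P a i ≡ P a j
  same-type {i} {j} cᵢ≡cⱼ a =
    trans (sym (agrees a i)) (trans (cong (A ((x ∷ y ∷ []) a)) cᵢ≡cⱼ) (agrees a j))

  columns-injective : Injective _≡_ _≡_ columns
  columns-injective {i} {j} cᵢ≡cⱼ with P zero i Bool.≟ P (suc zero) i
  ... | yes constant = constant-columns-equal P noH refl (sym constant) (sym (same-type cᵢ≡cⱼ zero))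
                         (trans (sym (same-type cᵢ≡cⱼ (suc zero))) (sym constant))
  ... | no mixed = typed-injective mixed (trans cᵢ≡cⱼ (cong₂ (λ a b → typed a b j)
                     (sym (same-type cᵢ≡cⱼ zero)) (sym (same-type cᵢ≡cⱼ (suc zero)))))

∣q∣≤∣p∣⇒∣q─p∣≤∣p─q∣ : (p q : Fin n → Bool) → ∣ q ∣ ≤ ∣ p ∣ → ∣ q ─ p ∣ ≤ ∣ p ─ q ∣
∣q∣≤∣p∣⇒∣q─p∣≤∣p─q∣ p q ∣q∣≤∣p∣ = +-cancelˡ-≤ ∣ p ∩ q ∣ _ _ (begin
  ∣ p ∩ q ∣ + ∣ q ─ p ∣   ≡⟨ cong (_+ ∣ q ─ p ∣) (∣∣-cong (λ j → Bool.∧-comm (p j) (q j))) ⟩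
  ∣ q ∩ p ∣ + ∣ q ─ p ∣   ≡⟨ ∣p∣≡∣p∩q∣+∣p─q∣ q p ⟨
  ∣ q ∣                   ≤⟨ ∣q∣≤∣p∣ ⟩
  ∣ p ∣                   ≡⟨ ∣p∣≡∣p∩q∣+∣p─q∣ p q ⟩
  ∣ p ∩ q ∣ + ∣ p ─ q ∣   ∎)
  where open ≤-Reasoning

sparse-overlap⇒common-zero : (p q : Fin n → Bool) →
  2 * ∣ p ∣ ≤ n → 2 * ∣ q ∣ ≤ n → 0 < ∣ p ∩ q ∣ → 0 < ∣ ∁ (p ∪ q) ∣
sparse-overlap⇒common-zero {n} p q 2∣p∣≤n 2∣q∣≤n 0<∣p∩q∣ = n≢0⇒n>0 λ ∣∁p∪q∣≡0 →
  <-irrefl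
    (trans (sym (+-identityʳ _)) (trans (cong (∣ p ∪ q ∣ +_) (sym ∣∁p∪q∣≡0)) (∣p∣+∣∁p∣≡n (p ∪ q))))
    (begin-strict
      ∣ p ∪ q ∣                 <⟨ m<m+n ∣ p ∪ q ∣ 0<∣p∩q∣ ⟩
      ∣ p ∪ q ∣ + ∣ p ∩ q ∣     ≡⟨ ∣p∣+∣q∣≡∣p∪q∣+∣p∩q∣ p q ⟨
      ∣ p ∣ + ∣ q ∣             ≤⟨ 2m≤o⇒2n≤o⇒m+n≤o ∣ p ∣ ∣ q ∣ 2∣p∣≤n 2∣q∣≤n ⟩
      n                         ∎)
  where open ≤-Reasoning

QFree-complement : (A : Matrix m n) → QFree k A → QFree k (complement A)
QFree-complement A free {x} {y} x≢y k≤∣x─y∣ k≤∣y─x∣ 0<∣x∩y∣ 0<∣∁x∪y∣ =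
  free x≢y
    (subst (_ ≤_) (∣∣-cong (λ j → swapped-difference (A y j) (A x j))) k≤∣y─x∣)
    (subst (_ ≤_) (∣∣-cong (λ j → swapped-difference (A x j) (A y j))) k≤∣x─y∣)
    (subst (0 <_) (∣∣-cong (λ j → de-morgan-∨ (A x j) (A y j))) 0<∣∁x∪y∣)
    (subst (0 <_) (∣∣-cong (λ j → de-morgan-∧ (A x j) (A y j))) 0<∣x∩y∣)
  where
  swapped-difference : ∀ a b → not a ∧ not (not b) ≡ b ∧ not a
  swapped-difference a b rewrite Bool.not-involutive b = Bool.∧-comm (not a) b
  de-morgan-∨ : ∀ a b → not (not a ∨ not b) ≡ a ∧ b
  de-morgan-∨ true  b = Bool.not-involutive b
  de-morgan-∨ false b = refl
  de-morgan-∧ : ∀ a b → not a ∧ not b ≡ not (a ∨ b)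
  de-morgan-∧ true  b = refl
  de-morgan-∧ false b = refl

-- The rows share a one and, being sparse, a zero; so Q_k-freeness bounds one of the two
-- differences by k, and ∣ A y ∣ ≤ ∣ A x ∣ makes it A y ─ A x.
sparse-overlap⇒∣─∣≤ : (A : Matrix m n) → QFree k A → ∀ {x y} →
  2 * ∣ A x ∣ ≤ n → 2 * ∣ A y ∣ ≤ n → ∣ A y ∣ ≤ ∣ A x ∣ → 0 < ∣ A x ∩ A y ∣ → ∣ A y ─ A x ∣ ≤ k
sparse-overlap⇒∣─∣≤ {k = k} A free {x} {y} 2∣x∣≤n 2∣y∣≤n ∣y∣≤∣x∣ 0<∣x∩y∣ with x Fin.≟ y
... | yes refl = ≤-trans (≤-reflexive (∣p─p∣≡0 (A x))) z≤n
... | no x≢y with k ≤? ∣ A y ─ A x ∣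
...   | no k≰  = <⇒≤ (≰⇒> k≰)
...   | yes k≤ = ⊥-elim (free x≢y (≤-trans k≤ (∣q∣≤∣p∣⇒∣q─p∣≤∣p─q∣ (A x) (A y) ∣y∣≤∣x∣)) k≤ 0<∣x∩y∣
                   (sparse-overlap⇒common-zero (A x) (A y) 2∣x∣≤n 2∣y∣≤n 0<∣x∩y∣))

-- Greedy absorption of sparse rows

module Greedy {m n k s : ℕ} (B : Matrix m n) (free : QFree k B)
  (R : Fin m → Bool) (R-sparse : ∀ {x} → x ∈ R → 2 * ∣ B x ∣ ≤ n) (m≤2∣R∣ : m ≤ 2 * ∣ R ∣)
  (4t≤m : 4 * (suc k * s) ≤ m) (4t≤n : 4 * (suc k * s) ≤ n) where

  s≤t : s ≤ suc k * s
  s≤t = m≤m+n s (k * s)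

  -- W: sparse rows still waiting, R ─ W: absorbed rows, U: collected columns.
  record Invariant (U : Fin n → Bool) (W : Fin m → Bool) : Set where
    field
      W⊆R             : W ⊆ R
      waiting-avoid-U : ∀ {y j} → y ∈ W → j ∈ U → B y j ≡ false
      absorbed-sparse : ∀ {y} → y ∈ R ─ W → ∣ B y ─ U ∣ ≤ k
      4∣U∣≤3n         : 4 * ∣ U ∣ ≤ 3 * n

  initial : Invariant ∅ R
  initial = record
    { W⊆R             = λ y∈R → y∈R
    ; waiting-avoid-U = λ _ ()
    ; absorbed-sparse = λ y∈R─R → let y∈R , y∉R = ∈─⁻ R R y∈R─R in case trans (sym y∈R) y∉R of λ ()
    ; 4∣U∣≤3n         = ≤-trans (≤-reflexive (cong (4 *_) (∣∅∣≡0 n))) z≤n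
    }

  module _ {U W} (inv : Invariant U W) where
    open Invariant inv

    ∣R∣≡∣W∣+∣R─W∣ : ∣ R ∣ ≡ ∣ W ∣ + ∣ R ─ W ∣
    ∣R∣≡∣W∣+∣R─W∣ = p⊆q⇒∣q∣≡∣p∣+∣q─p∣ W R W⊆R

    half-absorbed⇒block : 2 * ∣ W ∣ ≤ ∣ R ∣ → HomogeneousBlock B s
    half-absorbed⇒block 2∣W∣≤∣R∣ = sparse⇒block B (R ─ W) (∁ U) t≤∣R─W∣ t≤∣∁U∣ absorbed-sparse
      where
      open ≤-Reasoning
      t≤∣R─W∣ : suc k * s ≤ ∣ R ─ W ∣
      t≤∣R─W∣ = *-cancelˡ-≤ 4 (begin
        4 * (suc k * s)        ≤⟨ 4t≤m ⟩
        m                      ≤⟨ m≤2∣R∣ ⟩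
        2 * ∣ R ∣              ≤⟨ *-monoʳ-≤ 2 (m≡n+o⇒2n≤m⇒m≤2o ∣ R ∣ ∣ W ∣ ∣R∣≡∣W∣+∣R─W∣ 2∣W∣≤∣R∣) ⟩
        2 * (2 * ∣ R ─ W ∣)    ≡⟨ *-assoc 2 2 ∣ R ─ W ∣ ⟨
        4 * ∣ R ─ W ∣          ∎)
      t≤∣∁U∣ : suc k * s ≤ ∣ ∁ U ∣
      t≤∣∁U∣ = *-cancelˡ-≤ 4 (≤-trans 4t≤n (m+n≡o⇒4m≤3o⇒o≤4n ∣ U ∣ ∣ ∁ U ∣ (∣p∣+∣∁p∣≡n U) 4∣U∣≤3n))

    large-U⇒block : ∣ R ∣ < 2 * ∣ W ∣ → n ≤ 4 * ∣ U ∣ → HomogeneousBlock B s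
    large-U⇒block ∣R∣<2∣W∣ n≤4∣U∣ =
      zero-block W U (≤-trans s≤t t≤∣W∣) (≤-trans s≤t t≤∣U∣) waiting-avoid-U
      where
      open ≤-Reasoning
      t≤∣W∣ : suc k * s ≤ ∣ W ∣
      t≤∣W∣ = *-cancelˡ-≤ 4 (begin
        4 * (suc k * s)        ≤⟨ 4t≤m ⟩
        m                      ≤⟨ m≤2∣R∣ ⟩
        2 * ∣ R ∣              ≤⟨ *-monoʳ-≤ 2 (<⇒≤ ∣R∣<2∣W∣) ⟩
        2 * (2 * ∣ W ∣)        ≡⟨ *-assoc 2 2 ∣ W ∣ ⟨
        4 * ∣ W ∣              ∎)
      t≤∣U∣ : suc k * s ≤ ∣ U ∣
      t≤∣U∣ = *-cancelˡ-≤ 4 (≤-trans 4t≤n n≤4∣U∣)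

    module Absorb {x} (x∈W : x ∈ W) (x-max : ∀ {y} → y ∈ W → ∣ B y ∣ ≤ ∣ B x ∣)
                  (4∣U∣<n : 4 * ∣ U ∣ < n) where
      near : Fin m → Bool
      near = setOf (λ y → ∣ B y ─ B x ∣ ≤? k)

      U′ : Fin n → Bool
      U′ = U ∪ B x

      W′ : Fin m → Bool
      W′ = W ─ near

      W′⊆W : W′ ⊆ W
      W′⊆W y∈W′ = proj₁ (∈─⁻ W near y∈W′)

      overlap⇒near : ∀ {y j} → y ∈ W → j ∈ B x → j ∈ B y → y ∈ near
      overlap⇒near {y} y∈W j∈Bx j∈By = ∈setOf⁺ (λ y → ∣ B y ─ B x ∣ ≤? k)
        (sparse-overlap⇒∣─∣≤ B free (R-sparse (W⊆R x∈W)) (R-sparse (W⊆R y∈W)) (x-max y∈W)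
          (∈⇒0<∣p∣ (B x ∩ B y) (∈∩⁺ (B x) (B y) j∈Bx j∈By)))

      x∈near : x ∈ near
      x∈near = ∈setOf⁺ (λ y → ∣ B y ─ B x ∣ ≤? k) (≤-trans (≤-reflexive (∣p─p∣≡0 (B x))) z≤n)

      ∣W′∣<∣W∣ : ∣ W′ ∣ < ∣ W ∣
      ∣W′∣<∣W∣ = p⊆q⇒∣p∣<∣q∣ W′ W W′⊆W x∈W x∉W′
        where
        x∉W′ : W′ x ≡ false
        x∉W′ rewrite x∈W | x∈near = refl

      waiting-avoid-U′ : ∀ {y j} → y ∈ W′ → j ∈ U′ → B y j ≡ false
      waiting-avoid-U′ {y} {j} y∈W′ j∈U′ with ∈─⁻ W near y∈W′ | ∈∪⁻ U (B x) j∈U′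
      ... | y∈W , _      | inj₁ j∈U  = waiting-avoid-U y∈W j∈U
      ... | y∈W , y∉near | inj₂ j∈Bx with B y j in Byj
      ...   | false = refl
      ...   | true  = trans (sym (overlap⇒near y∈W j∈Bx Byj)) y∉near

      absorbed-sparse′ : ∀ {y} → y ∈ R ─ W′ → ∣ B y ─ U′ ∣ ≤ k
      absorbed-sparse′ {y} y∈R─W′ = let y∈R , y∉W′ = ∈─⁻ R W′ y∈R─W′ in split y∈R y∉W′
        where
        split : y ∈ R → W′ y ≡ false → ∣ B y ─ U′ ∣ ≤ k
        split y∈R y∉W′ with W y in Wy | near y in ay
        ... | false | _    = ≤-trans
          (p⊆q⇒∣p∣≤∣q∣ (B y ─ U′) (B y ─ U) (─-antitoneʳ (B y) U U′ (p⊆p∪q U (B x))))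
          (absorbed-sparse (∈─⁺ R W y∈R Wy))
        ... | true  | true = ≤-trans
          (p⊆q⇒∣p∣≤∣q∣ (B y ─ U′) (B y ─ B x) (─-antitoneʳ (B y) (B x) U′ (q⊆p∪q U (B x))))
          (∈setOf⁻ (λ y → ∣ B y ─ B x ∣ ≤? k) ay)

      4∣U′∣≤3n : 4 * ∣ U′ ∣ ≤ 3 * n
      4∣U′∣≤3n = ≤-trans (*-monoʳ-≤ 4 (∣p∪q∣≤∣p∣+∣q∣ U (B x)))
        (4m≤o⇒2n≤o⇒4[m+n]≤3o ∣ U ∣ ∣ B x ∣ (<⇒≤ 4∣U∣<n) (R-sparse (W⊆R x∈W)))

      invariant′ : Invariant U′ W′
      invariant′ = record
        { W⊆R             = λ y∈W′ → W⊆R (W′⊆W y∈W′)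
        ; waiting-avoid-U = waiting-avoid-U′
        ; absorbed-sparse = absorbed-sparse′
        ; 4∣U∣≤3n         = 4∣U′∣≤3n
        }

    step : ∣ R ∣ < 2 * ∣ W ∣ → 4 * ∣ U ∣ < n → Σ (Fin n → Bool) λ U′ → Σ (Fin m → Bool) λ W′ →
           Invariant U′ W′ × ∣ W′ ∣ < ∣ W ∣
    step ∣R∣<2∣W∣ 4∣U∣<n =
      let w , w∈W         = 0<∣p∣⇒∃∈ W (*-cancelˡ-< 2 0 ∣ W ∣ (≤-<-trans z≤n ∣R∣<2∣W∣))
          x , x∈W , x-max = argmax-on {p = W} (λ y → ∣ B y ∣) w∈W
          open Absorb x∈W x-max 4∣U∣<n
      in U′ , W′ , invariant′ , ∣W′∣<∣W∣

  greedy : ∀ {U W} → Acc _<_ ∣ W ∣ → Invariant U W → HomogeneousBlock B s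
  greedy {U} {W} (acc smaller) inv with 2 * ∣ W ∣ ≤? ∣ R ∣ | n ≤? 4 * ∣ U ∣
  ... | yes 2∣W∣≤∣R∣ | _          = half-absorbed⇒block inv 2∣W∣≤∣R∣
  ... | no 2∣W∣≰∣R∣  | yes n≤4∣U∣ = large-U⇒block inv (≰⇒> 2∣W∣≰∣R∣) n≤4∣U∣
  ... | no 2∣W∣≰∣R∣  | no n≰4∣U∣  =
    let _ , _ , inv′ , shrinks = step inv (≰⇒> 2∣W∣≰∣R∣) (≰⇒> n≰4∣U∣) in greedy (smaller shrinks) inv′

  block : HomogeneousBlock B s
  block = greedy (<-wellFounded ∣ R ∣) initial

sparseRows : Matrix m n → Fin m → Bool
sparseRows {n = n} A = setOf (λ x → 2 * ∣ A x ∣ ≤? n)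

m≤∣sparseRows∣+∣sparseRows∁∣ : (A : Matrix m n) →
  m ≤ ∣ sparseRows A ∣ + ∣ sparseRows (complement A) ∣
m≤∣sparseRows∣+∣sparseRows∁∣ {m} {n} A = begin
  m                                                    ≡⟨ ∣p∣≡n every-row-sparse ⟨
  ∣ sparseRows A ∪ sparseRows (complement A) ∣         ≤⟨ ∣p∪q∣≤∣p∣+∣q∣ _ (sparseRows (complement A)) ⟩
  ∣ sparseRows A ∣ + ∣ sparseRows (complement A) ∣     ∎
  where
  open ≤-Reasoning
  every-row-sparse : ∀ x → x ∈ sparseRows A ∪ sparseRows (complement A)
  every-row-sparse x = ∈∪⁺ (sparseRows A) (sparseRows (complement A))
    (Sum.map (∈setOf⁺ (λ x → 2 * ∣ A x ∣ ≤? n)) (∈setOf⁺ (λ x → 2 * ∣ complement A x ∣ ≤? n))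
      (m+n≡o⇒2m≤o⊎2n≤o ∣ A x ∣ ∣ ∁ (A x) ∣ (∣p∣+∣∁p∣≡n (A x))))

QFree⇒block : (A : Matrix m n) → QFree k A →
  4 * (suc k * s) ≤ m → 4 * (suc k * s) ≤ n → HomogeneousBlock A s
QFree⇒block {m} {n} A free 4t≤m 4t≤n
  with m≤n+o⇒m≤2n⊎m≤2o ∣ sparseRows A ∣ ∣ sparseRows (complement A) ∣ (m≤∣sparseRows∣+∣sparseRows∁∣ A)
... | inj₁ m≤2∣S∣ =
  Greedy.block A free (sparseRows A) (∈setOf⁻ (λ x → 2 * ∣ A x ∣ ≤? n)) m≤2∣S∣ 4t≤m 4t≤n
... | inj₂ m≤2∣S∣ = block-complement
  (Greedy.block (complement A) (QFree-complement A free) (sparseRows (complement A))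
    (∈setOf⁻ (λ x → 2 * ∣ complement A x ∣ ≤? n)) m≤2∣S∣ 4t≤m 4t≤n)

empty-sub : (A : Matrix m n) → HasHomogeneousSub A 0 0
empty-sub A = (λ ()) , (λ ()) , (λ ()) , (λ ()) , (λ ())

single-entry-sub : (A : Matrix m n) → Fin m → Fin n → HasHomogeneousSub A 1 1
single-entry-sub A i j =
  (λ _ → i) , (λ _ → j) , (λ { zero zero () }) , (λ { zero zero () }) , λ { zero zero zero zero → refl }

m≤2n[m/n] : ∀ m n .{{_ : NonZero n}} → n ≤ m → m ≤ 2 * n * (m / n)
m≤2n[m/n] m n n≤m = begin
  m                        ≡⟨ m≡m%n+[m/n]*n m n ⟩
  m % n + m / n * n        ≤⟨ +-monoˡ-≤ (m / n * n) (<⇒≤ (m%n<n m n)) ⟩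
  n + m / n * n            ≤⟨ +-monoˡ-≤ (m / n * n) (m≤n*m n (m / n) {{>-nonZero (m≥n⇒m/n>0 n≤m)}}) ⟩
  m / n * n + m / n * n    ≡⟨ double (m / n) n ⟩
  2 * n * (m / n)          ∎
  where
  open ≤-Reasoning
  double : ∀ q n → q * n + q * n ≡ 2 * n * q
  double = solve-∀

QFree⇒homogeneousSub : (A : Matrix n n) → QFree k A →
  Σ ℕ λ s → n ≤ 2 * (4 * suc k) * s × HasHomogeneousSub A s s
QFree⇒homogeneousSub {zero} A _ = 0 , z≤n , empty-sub A
QFree⇒homogeneousSub {n@(suc _)} {k} A free with n <? 4 * suc k
... | yes n<4[1+k] = 1 , ≤-trans (<⇒≤ n<4[1+k]) (subst (4 * suc k ≤_) (sym (*-identityʳ _)) (m≤n*m _ 2))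
              , single-entry-sub A zero zero
... | no n≮4[1+k]  = n / (4 * suc k) , m≤2n[m/n] n (4 * suc k) (≮⇒≥ n≮4[1+k])
              , block⇒homogeneousSub (QFree⇒block A free 4t≤n 4t≤n)
  where
  4t≤n : 4 * (suc k * (n / (4 * suc k))) ≤ n
  4t≤n = subst (_≤ n) (reorder k (n / (4 * suc k))) (m/n*n≤m n (4 * suc k))
    where
    reorder : ∀ k q → q * (4 * suc k) ≡ 4 * (suc k * q)
    reorder = solve-∀

theorem1p6 : (k : ℕ) (P : Matrix 2 k) → NoHomogeneous2x2 P →
    Σ ℕ λ d → 0 < d × ((n : ℕ) (A : Matrix n n) → UnorderedFree A P →
      Σ ℕ λ s → n ≤ d * s × HasHomogeneousSub A s s)
theorem1p6 k P noH = 2 * (4 * suc k) , s≤s z≤n ,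
  λ n A free → QFree⇒homogeneousSub A (unorderedFree⇒QFree P noH A free)
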